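{- Let $\ell$ be a positive integer. A signed graph $(G,\sigma)$ admits a modulo $\ell$-orientation if and only if there is a partition $\{E_1,\dots,E_\ell\}$ of $E(G)$ such that: (i) for each $i$, $E_i$ is the set of positive edges of some signature on $G$ that is inversing equivalent to $\sigma$; and (ii) there is an orientation of $G$ such that for every vertex $v$ and every $i,j\in\{1,\dots,\ell\}$, $$\overleftarrow{d_{E_i}}(v)-\overrightarrow{d_{E_i}}(v)=\overleftarrow{d_{E_j}}(v)-\overrightarrow{d_{E_j}}(v),$$ where $\overleftarrow{d_{E_i}}(v)$ and $\overrightarrow{d_{E_i}}(v)$ denote the numbers of edges of $E_i$ oriented out of $v$ and into $v$, respectively.
   Context: Graphs are finite, may have multiple edges but no loops; a signed graph $(G,\sigma)$ has $\sigma:E(G)\to\{+,-\}$. Inversing on a cycle means changing the signs of all its edges; two signatures are inversing equivalent if one is obtained from the other by inversing on a sequence of cycles. A signed graph $(G,\sigma)$ is modulo $\ell$-orientable if there exist a signature $\sigma'$ inversing equivalent to $\sigma$ and an orientation $D$ of $G$ such that, with respect to $\sigma'$, for every vertex $v$, $(\ell-1)(\overleftarrow{d^+}(v)-\overrightarrow{d^+}(v))=\overleftarrow{d^- }(v)-\overrightarrow{d^- }(v)$, where $\overleftarrow{d^{+}}(v)$ ($\overrightarrow{d^{+}}(v)$) is the number of positive edges oriented out of (into) $v$, and similarly $\overleftarrow{d^{ - }},\overrightarrow{d^{ - }}$ for negative edges; such $D$ is a modulo $\ell$-orientation. -}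

module Defs where

open import Data.Nat using (ℕ; zero; suc; _+_)
open import Data.Integer as ℤ using (ℤ; +_; _-_; _*_)
open import Data.Fin using (Fin; zero; suc; _≟_)
open import Data.Fin.Properties using () renaming (_≟_ to _≟F_)
open import Data.Bool using (Bool; true; false; _∧_; if_then_else_)
open import Data.Product using (Σ; ∃; _×_; _,_; proj₁; proj₂)
open import Data.Sum using (_⊎_)
open import Data.Empty using (⊥)
open import Relation.Nullary using (¬_)
open import Relation.Nullary.Decidable using (⌊_⌋)
open import Relation.Binary.PropositionalEquality using (_≡_; _≢_)
open import Relation.Binary.Construct.Closure.ReflexiveTransitive using (Star)
open import Function.Definitions using (Injective)

record Graph : Set where
  field
    n     : ℕ
    m     : ℕ
    ends  : Fin m → Fin n × Fin n
    loopless : ∀ e → proj₁ (ends e) ≢ proj₂ (ends e)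
open Graph public

V : Graph → Set
V G = Fin (n G)

E : Graph → Set
E G = Fin (m G)

data Sign : Set where
  ⊕ ⊖ : Sign

flipSign : Sign → Sign
flipSign ⊕ = ⊖
flipSign ⊖ = ⊕

isPos : Sign → Bool
isPos ⊕ = true
isPos ⊖ = false

isNeg : Sign → Bool
isNeg ⊕ = false
isNeg ⊖ = true

Signature : Graph → Set
Signature G = E G → Sign

Joins : (G : Graph) → E G → V G → V G → Set
Joins G e x y = (proj₁ (ends G e) ≡ x × proj₂ (ends G e) ≡ y)
              ⊎ (proj₁ (ends G e) ≡ y × proj₂ (ends G e) ≡ x)

-- cyclic successor on Fin (suc k)
next : ∀ {k} → Fin (suc k) → Fin (suc k)
next {zero}  zero    = zero
next {suc k} zero    = suc zero
next {suc k} (suc i) with next {k} i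
... | zero  = zero
... | suc j = suc (suc j)

-- A cycle of length (suc (suc k)) ≥ 2: distinct vertices vs 0 … vs (k+1),
-- distinct edges es 0 … es (k+1), where es i joins vs i and vs (i+1 mod k+2).
-- (Length 2 cycles arise from parallel edges.)
record Cycle (G : Graph) : Set where
  field
    k     : ℕ
    vs    : Fin (suc (suc k)) → V G
    es    : Fin (suc (suc k)) → E G
    vs-inj : Injective _≡_ _≡_ vs
    es-inj : Injective _≡_ _≡_ es
    joins : ∀ i → Joins G (es i) (vs i) (vs (next i))

_∈C_ : ∀ {G} → E G → Cycle G → Set
e ∈C C = ∃ λ i → Cycle.es C i ≡ e

InverseOn : (G : Graph) → Cycle G → Signature G → Signature G → Set
InverseOn G C σ σ' =
  ∀ e → (e ∈C C → σ' e ≡ flipSign (σ e)) × (¬ (e ∈C C) → σ' e ≡ σ e)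

InvStep : (G : Graph) → Signature G → Signature G → Set
InvStep G σ σ' = Σ (Cycle G) λ C → InverseOn G C σ σ'

InvEquiv : (G : Graph) → Signature G → Signature G → Set
InvEquiv G = Star (InvStep G)

-- An orientation: for each edge, true = oriented from proj₁ to proj₂ of its
-- ends, false = reversed.
Orientation : Graph → Set
Orientation G = E G → Bool

tail : (G : Graph) → Orientation G → E G → V G
tail G D e = if D e then proj₁ (ends G e) else proj₂ (ends G e)

head : (G : Graph) → Orientation G → E G → V G
head G D e = if D e then proj₂ (ends G e) else proj₁ (ends G e)

count : ∀ {m} → (Fin m → Bool) → ℕ
count {zero}  p = 0
count {suc m} p = (if p zero then 1 else 0) + count {m} (λ i → p (suc i))

outDeg : (G : Graph) → Orientation G → (E G → Bool) → V G → ℕ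
outDeg G D S v = count (λ e → ⌊ tail G D e ≟F v ⌋ ∧ S e)

inDeg : (G : Graph) → Orientation G → (E G → Bool) → V G → ℕ
inDeg G D S v = count (λ e → ⌊ head G D e ≟F v ⌋ ∧ S e)

netDeg : (G : Graph) → Orientation G → (E G → Bool) → V G → ℤ
netDeg G D S v = + outDeg G D S v - + inDeg G D S v

IsModOrientation : (G : Graph) → ℕ → Signature G → Orientation G → Set
IsModOrientation G ℓ σ D =
  ∀ v → (+ ℓ - + 1) * netDeg G D (λ e → isPos (σ e)) v
        ≡ netDeg G D (λ e → isNeg (σ e)) v

ModOrientable : (G : Graph) → ℕ → Signature G → Set
ModOrientable G ℓ σ =
  ∃ λ (σ' : Signature G) → InvEquiv G σ σ' ×
  ∃ λ (D : Orientation G) → IsModOrientation G ℓ σ' D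

-- class E_i of a partition given by a labelling part : E G → Fin ℓ
inClass : ∀ {G : Graph} {ℓ} → (E G → Fin ℓ) → Fin ℓ → E G → Bool
inClass part i e = ⌊ part e ≟F i ⌋

GoodPartition : (G : Graph) → (ℓ : ℕ) → Signature G → (E G → Fin ℓ) → Set
GoodPartition G ℓ σ part =
  (∀ (i : Fin ℓ) → ∃ λ (σᵢ : Signature G) → InvEquiv G σ σᵢ ×
      (∀ e → isPos (σᵢ e) ≡ inClass {G} part i e))
  × (∃ λ (D : Orientation G) → ∀ (v : V G) (i j : Fin ℓ) →
      netDeg G D (inClass {G} part i) v ≡ netDeg G D (inClass {G} part j) v)

-- Net degrees are linear in the edge set, net D S v = ∑_{e ∈ S} (δ (tail e) v − δ (head e) v), so
-- everything is computed with integer sums.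
--
-- (⇐) If the classes E₀, …, E_{ℓ−1} share the net degree N, the signature whose positive edges
-- are E₀ works: its negative edges have net degree ℓN − N = (ℓ − 1)N.
--
-- (⇒) Let P be the positive edges of the equivalent signature σ′ and f = net P; the modulo ℓ
-- condition says that the whole edge set has net degree ℓf. Classes of net degree f are split
-- off one at a time by augmenting paths in a residual graph: a cut argument shows that a vertex
-- of positive excess always reaches one of negative excess. For a class Eᵢ, σ′ disagrees with
-- the signature positive exactly on Eᵢ on P Δ Eᵢ, which becomes balanced once Eᵢ ∖ P is
-- reversed; a balanced edge set contains a directed cycle, and inversing along such cycles one
-- at a time turns σ′ into that signature.
module Submission where

open import Defs

open import Data.Nat as ℕ using (ℕ; zero; suc)
import Data.Nat.Properties as ℕP
open import Data.Integer as ℤ using (ℤ; +_; 0ℤ; 1ℤ; -1ℤ; _+_; _-_; _*_; -_; _≤_; _<_; ∣_∣)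
import Data.Integer.Properties as ℤP
open import Data.Integer.Tactic.RingSolver using (solve-∀)
open import Data.Fin using (Fin; zero; suc; toℕ; fromℕ; fromℕ<; inject; inject₁)
import Data.Fin.Properties as FinP
open import Data.Fin.Properties using (_≟_; any?)
open import Data.Bool using (Bool; true; false; _∧_; _∨_; _xor_; not; if_then_else_)
import Data.Bool.Properties as Bool
open import Data.Product using (∃; Σ; _×_; _,_; proj₁; proj₂)
open import Data.Sum using (_⊎_; inj₁; inj₂)
open import Relation.Nullary using (¬_; ¬?; Dec; does; yes; no; contradiction)
open import Relation.Nullary.Decidable using (⌊_⌋; ⌊⌋-map′; _×-dec_; isYes≗does; dec-true; dec-false; does-⇔; decidable-stable)
open import Relation.Binary.PropositionalEquality
open import Relation.Binary.Construct.Closure.ReflexiveTransitive using (ε; _◅_; _◅◅_)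
open import Relation.Binary.Definitions using (tri<; tri≈; tri>)
open import Function using (case_of_)
open import Function.Bundles using (_⇔_; mk⇔)
open import Function.Definitions using (Injective)
open import Algebra.Properties.Semiring.Sum ℤP.+-*-semiring
  using (sum; sum-syntax; sum-cong-≗; ∑-distrib-+; ∑-comm; *-distribˡ-sum; *-distribʳ-sum; sum-replicate-zero)

𝟙 : Bool → ℤ
𝟙 true  = 1ℤ
𝟙 false = 0ℤ

𝟙-∧ : ∀ a b → 𝟙 (a ∧ b) ≡ 𝟙 a * 𝟙 b
𝟙-∧ true  b = sym (ℤP.*-identityˡ (𝟙 b))
𝟙-∧ false b = refl

𝟙-nonneg : ∀ b → 0ℤ ≤ 𝟙 b
𝟙-nonneg true  = ℤ.+≤+ ℕ.z≤n
𝟙-nonneg false = ℤ.+≤+ ℕ.z≤n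

𝟙≤1 : ∀ b → 𝟙 b ≤ 1ℤ
𝟙≤1 true  = ℤP.≤-refl
𝟙≤1 false = ℤ.+≤+ ℕ.z≤n

-- `does` rather than `⌊_⌋` (as in Defs), so that δ (suc a) (suc b) reduces to δ a b.
δ : ∀ {n} → Fin n → Fin n → ℤ
δ a b = 𝟙 (does (a ≟ b))

δ-refl : ∀ {n} (a : Fin n) → δ a a ≡ 1ℤ
δ-refl a = cong 𝟙 (dec-true (a ≟ a) refl)

δ-≢ : ∀ {n} {a b : Fin n} → a ≢ b → δ a b ≡ 0ℤ
δ-≢ {a = a} {b} a≢b = cong 𝟙 (dec-false (a ≟ b) a≢b)

module _ {n : ℕ} where

  ∑-neg : (f : Fin n → ℤ) → ∑[ i < n ] (- f i) ≡ - sum f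
  ∑-neg f = begin
    ∑[ i < n ] (- f i)      ≡⟨ sum-cong-≗ (λ i → sym (ℤP.-1*i≡-i (f i))) ⟩
    ∑[ i < n ] (-1ℤ * f i)  ≡⟨ sym (*-distribˡ-sum -1ℤ f) ⟩
    -1ℤ * sum f             ≡⟨ ℤP.-1*i≡-i (sum f) ⟩
    - sum f                 ∎
    where open ≡-Reasoning

  ∑-distrib-- : (f g : Fin n → ℤ) → ∑[ i < n ] (f i - g i) ≡ sum f - sum g
  ∑-distrib-- f g = trans (∑-distrib-+ f (λ i → - g i)) (cong (λ x → sum f + x) (∑-neg g))

  ∑-zero : ∑[ i < n ] 0ℤ ≡ 0ℤ
  ∑-zero = sum-replicate-zero n

∑-const : ∀ {n} c → ∑[ i < n ] c ≡ + n * c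
∑-const {zero}  c = sym (ℤP.*-zeroˡ c)
∑-const {suc n} c = trans (cong (λ x → c + x) (∑-const {n} c)) (sym (ℤP.suc-* (+ n) c))

∑-δ : ∀ {n} (a : Fin n) (g : Fin n → ℤ) → ∑[ i < n ] (δ a i * g i) ≡ g a
∑-δ {suc n} zero g = begin
  1ℤ * g zero + ∑[ i < n ] (0ℤ * g (suc i))
    ≡⟨ cong₂ _+_ (ℤP.*-identityˡ (g zero)) (trans (sum-cong-≗ (λ i → ℤP.*-zeroˡ (g (suc i)))) (∑-zero {n})) ⟩
  g zero + 0ℤ
    ≡⟨ ℤP.+-identityʳ (g zero) ⟩
  g zero ∎
  where open ≡-Reasoning
∑-δ {suc n} (suc a) g = trans (ℤP.+-identityˡ _) (∑-δ a (λ i → g (suc i)))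

∑-δ₁ : ∀ {n} (a : Fin n) → ∑[ i < n ] δ a i ≡ 1ℤ
∑-δ₁ a = trans (sum-cong-≗ (λ i → sym (ℤP.*-identityʳ (δ a i)))) (∑-δ a (λ _ → 1ℤ))

∑-mono-≤ : ∀ {n} {f g : Fin n → ℤ} → (∀ i → f i ≤ g i) → sum f ≤ sum g
∑-mono-≤ {zero}  _   = ℤP.≤-refl
∑-mono-≤ {suc n} f≤g = ℤP.+-mono-≤ (f≤g zero) (∑-mono-≤ (λ i → f≤g (suc i)))

∑-mono-< : ∀ {n} {f g : Fin n → ℤ} → (∀ i → f i ≤ g i) → ∀ j → f j < g j → sum f < sum g
∑-mono-< {suc n} f≤g zero    f<g = ℤP.+-mono-<-≤ f<g (∑-mono-≤ (λ i → f≤g (suc i)))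
∑-mono-< {suc n} f≤g (suc j) f<g = ℤP.+-mono-≤-< (f≤g zero) (∑-mono-< (λ i → f≤g (suc i)) j f<g)

∑-nonneg : ∀ {n} {f : Fin n → ℤ} → (∀ i → 0ℤ ≤ f i) → 0ℤ ≤ sum f
∑-nonneg {n} {f} 0≤f = subst (_≤ sum f) (∑-zero {n}) (∑-mono-≤ 0≤f)

∑-nonpos : ∀ {n} {f : Fin n → ℤ} → (∀ i → f i ≤ 0ℤ) → sum f ≤ 0ℤ
∑-nonpos {n} {f} f≤0 = subst (sum f ≤_) (∑-zero {n}) (∑-mono-≤ f≤0)

∑-term-≤ : ∀ {n} {f : Fin n → ℤ} → (∀ i → 0ℤ ≤ f i) → ∀ j → f j ≤ sum f
∑-term-≤ {suc n} {f} 0≤f zero = ℤP.i≤i+j (f zero) _ {{ℤ.nonNegative (∑-nonneg (λ i → 0≤f (suc i)))}}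
∑-term-≤ {suc n} {f} 0≤f (suc j) =
  ℤP.≤-trans (∑-term-≤ (λ i → 0≤f (suc i)) j) (ℤP.i≤j+i _ (f zero) {{ℤ.nonNegative (0≤f zero)}})

∑-nonpos-≡0 : ∀ {n} {f : Fin n → ℤ} → (∀ i → f i ≤ 0ℤ) → sum f ≡ 0ℤ → ∀ i → f i ≡ 0ℤ
∑-nonpos-≡0 {suc n} {f} f≤0 ∑f≡0 = λ { zero → head≡0 ; (suc i) → ∑-nonpos-≡0 (λ i → f≤0 (suc i)) tail≡0 i }
  where
  tail≤0 = ∑-nonpos (λ i → f≤0 (suc i))
  head≡0 : f zero ≡ 0ℤ
  head≡0 = ℤP.≤-antisym (f≤0 zero)
    (subst (_≤ f zero) ∑f≡0 (subst (sum f ≤_) (ℤP.+-identityʳ (f zero)) (ℤP.+-monoʳ-≤ (f zero) tail≤0)))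
  tail≡0 : ∑[ i < n ] f (suc i) ≡ 0ℤ
  tail≡0 = trans (sym (ℤP.+-identityˡ _)) (trans (cong (_+ ∑[ i < n ] f (suc i)) (sym head≡0)) ∑f≡0)

count≡∑ : ∀ {n} (p : Fin n → Bool) → + count p ≡ ∑[ i < n ] 𝟙 (p i)
count≡∑ {zero}  p = refl
count≡∑ {suc n} p with p zero
... | true  = trans (ℤP.pos-+ 1 (count (λ i → p (suc i)))) (cong (λ x → 1ℤ + x) (count≡∑ (λ i → p (suc i))))
... | false = trans (sym (ℤP.+-identityˡ _)) (cong (λ x → 0ℤ + x) (count≡∑ (λ i → p (suc i))))

_⊆_ : ∀ {A : Set} → (A → Bool) → (A → Bool) → Set
S ⊆ H = ∀ a → S a ≡ true → H a ≡ true

𝟙-mono : ∀ {a b} → (a ≡ true → b ≡ true) → 𝟙 a ≤ 𝟙 b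
𝟙-mono {false} {_}    _   = 𝟙-nonneg _
𝟙-mono {true}  {true} _   = ℤP.≤-refl
𝟙-mono {true}  {false} a⇒b = case a⇒b refl of λ ()

𝟙-∖ : ∀ {h s} → (s ≡ true → h ≡ true) → 𝟙 (h ∧ not s) ≡ 𝟙 h - 𝟙 s
𝟙-∖ {true}  {true}  _   = refl
𝟙-∖ {true}  {false} _   = refl
𝟙-∖ {false} {false} _   = refl
𝟙-∖ {false} {true}  s⇒h = case s⇒h refl of λ ()

dec-true⁻¹ : ∀ {A : Set} (d : Dec A) → does d ≡ true → A
dec-true⁻¹ (yes a) _ = a

dec-false⁻¹ : ∀ {A : Set} (d : Dec A) → does d ≡ false → ¬ A
dec-false⁻¹ (no ¬a) _ = ¬a

∧-true : ∀ {a b} → a ∧ b ≡ true → a ≡ true × b ≡ true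
∧-true {true} {true} _ = refl , refl

anyᵇ : ∀ {k} → (Fin k → Bool) → Bool
anyᵇ p = does (any? (λ i → p i Bool.≟ true))

anyᵇ-intro : ∀ {k} (p : Fin k → Bool) i → p i ≡ true → anyᵇ p ≡ true
anyᵇ-intro p i pᵢ = dec-true (any? (λ i → p i Bool.≟ true)) (i , pᵢ)

anyᵇ-elim : ∀ {k} (p : Fin k → Bool) → anyᵇ p ≡ true → ∃ λ i → p i ≡ true
anyᵇ-elim p = dec-true⁻¹ (any? (λ i → p i Bool.≟ true))

inImage : ∀ {k n} → (Fin k → Fin n) → Fin n → Bool
inImage w x = does (any? (λ r → w r ≟ x))

module _ {k n : ℕ} {w : Fin k → Fin n} (w-inj : Injective _≡_ _≡_ w) where

  ∑-δ-image : ∀ x → ∑[ r < k ] δ (w r) x ≡ 𝟙 (inImage w x)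
  ∑-δ-image x with any? (λ r → w r ≟ x)
  ... | no  x∉w          = trans (sum-cong-≗ (λ r → δ-≢ (λ wr≡x → x∉w (r , wr≡x)))) (∑-zero {k})
  ... | yes (r₀ , refl) = begin
    ∑[ r < k ] δ (w r) (w r₀)     ≡⟨ sum-cong-≗ {k} (λ r → δ-w {r}) ⟩
    ∑[ r < k ] δ r₀ r             ≡⟨ ∑-δ₁ r₀ ⟩
    1ℤ                            ∎
    where
    open ≡-Reasoning
    δ-w : ∀ {r} → δ (w r) (w r₀) ≡ δ r₀ r
    δ-w {r} = cong 𝟙 (does-⇔ (mk⇔ (λ p → sym (w-inj p)) (λ p → cong w (sym p))) (w r ≟ w r₀) (r₀ ≟ r))

  ∑-image : (g : Fin n → ℤ) → ∑[ x < n ] (𝟙 (inImage w x) * g x) ≡ ∑[ r < k ] g (w r)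
  ∑-image g = begin
    ∑[ x < n ] (𝟙 (inImage w x) * g x)             ≡⟨ sum-cong-≗ (λ x → cong (_* g x) (sym (∑-δ-image x))) ⟩
    ∑[ x < n ] (∑[ r < k ] δ (w r) x * g x)        ≡⟨ sum-cong-≗ (λ x → *-distribʳ-sum (g x) (λ r → δ (w r) x)) ⟩
    ∑[ x < n ] ∑[ r < k ] (δ (w r) x * g x)        ≡⟨ ∑-comm (λ x r → δ (w r) x * g x) ⟩
    ∑[ r < k ] ∑[ x < n ] (δ (w r) x * g x)        ≡⟨ sum-cong-≗ (λ r → ∑-δ (w r) g) ⟩
    ∑[ r < k ] g (w r)                             ∎
    where open ≡-Reasoning

next-cases : ∀ {k} (r : Fin (suc k)) → (toℕ r ≡ k × next r ≡ zero) ⊎ toℕ (next r) ≡ suc (toℕ r)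
next-cases {zero}  zero    = inj₁ (refl , refl)
next-cases {suc k} zero    = inj₂ refl
next-cases {suc k} (suc i) with next {k} i | next-cases {k} i
... | zero  | inj₁ (i≡k , _) = inj₁ (cong suc i≡k , refl)
... | suc j | inj₂ next≡suc  = inj₂ (cong suc next≡suc)

next-injective : ∀ {k} → Injective _≡_ _≡_ (next {k})
next-injective {k} {r} {r′} eq with next-cases r | next-cases r′
... | inj₁ (r≡k , _)      | inj₁ (r′≡k , _)       = FinP.toℕ-injective (trans r≡k (sym r′≡k))
... | inj₁ (_ , next≡0)   | inj₂ next′≡suc        =
  case trans (sym (cong toℕ (trans (sym eq) next≡0))) next′≡suc of λ ()
... | inj₂ next≡suc       | inj₁ (_ , next′≡0)    =
  case trans (sym (cong toℕ (trans eq next′≡0))) next≡suc of λ ()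
... | inj₂ next≡suc       | inj₂ next′≡suc        =
  FinP.toℕ-injective (ℕP.suc-injective (trans (sym next≡suc) (trans (cong toℕ eq) next′≡suc)))

next-surjective : ∀ {k} (r₀ : Fin (suc k)) → ∃ λ r → next r ≡ r₀
next-surjective {k} zero with next-cases (fromℕ k)
... | inj₁ (_ , next≡0) = fromℕ k , next≡0
... | inj₂ next≡suc     =
  contradiction (subst (ℕ._< suc k) (trans next≡suc (cong suc (FinP.toℕ-fromℕ k))) (FinP.toℕ<n _)) (ℕP.<-irrefl refl)
next-surjective {suc k} (suc r₀) with next-cases (inject₁ r₀)
... | inj₁ (r₀≡k , _) =
  contradiction (subst (ℕ._< suc k) (trans (sym (FinP.toℕ-inject₁ r₀)) r₀≡k) (FinP.toℕ<n r₀)) (ℕP.<-irrefl refl)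
... | inj₂ next≡suc    = inject₁ r₀ , FinP.toℕ-injective (trans next≡suc (cong suc (FinP.toℕ-inject₁ r₀)))

record Repetition {n} (w : ℕ → Fin n) : Set where
  field
    start end : ℕ
    start<end : start ℕ.< end
    closes    : w end ≡ w start
    distinct  : ∀ {p q} → p ℕ.< q → q ℕ.< end → w p ≢ w q

first-repetition : ∀ {n} (w : ℕ → Fin n) → Repetition w
first-repetition {n} w with FinP.¬∀⟶∃¬-smallest (suc n) Fresh fresh? repeats
  where
  Fresh : Fin (suc n) → Set
  Fresh j = ∀ (i : Fin (toℕ j)) → w (toℕ i) ≢ w (toℕ j)
  fresh? : ∀ j → Dec (Fresh j)
  fresh? j = FinP.all? (λ i → ¬? (w (toℕ i) ≟ w (toℕ j)))
  repeats : ¬ (∀ j → Fresh j)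
  repeats allFresh with FinP.pigeonhole (ℕP.n<1+n n) (λ j → w (toℕ j))
  ... | i , j , i<j , wi≡wj = allFresh j (fromℕ< i<j) (trans (cong w (FinP.toℕ-fromℕ< i<j)) wi≡wj)
... | j , ¬fresh , earlierFresh with FinP.¬∀⟶∃¬ (toℕ j) _ (λ i → ¬? (w (toℕ i) ≟ w (toℕ j))) ¬fresh
... | i , ¬wi≢wj = record
  { start = toℕ i ; end = toℕ j ; start<end = FinP.toℕ<n i
  ; closes = sym (decidable-stable (w (toℕ i) ≟ w (toℕ j)) ¬wi≢wj)
  ; distinct = distinct }
  where
  distinct : ∀ {p q} → p ℕ.< q → q ℕ.< toℕ j → w p ≢ w q
  distinct {p} {q} p<q q<j wp≡wq =
    earlierFresh q′ (fromℕ< p<q′) (trans (cong w (FinP.toℕ-fromℕ< p<q′)) (trans wp≡wq (cong w (sym q′≡q))))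
    where
    q′ = fromℕ< q<j
    q′≡q : toℕ (inject q′) ≡ q
    q′≡q = trans (FinP.toℕ-inject q′) (FinP.toℕ-fromℕ< q<j)
    p<q′ : p ℕ.< toℕ (inject q′)
    p<q′ = subst (p ℕ.<_) (sym q′≡q) p<q

+∣∣-pred : ∀ {x} → 1ℤ ≤ x → + ∣ x - 1ℤ ∣ ≡ + ∣ x ∣ - 1ℤ
+∣∣-pred {x} 1≤x =
  trans (ℤP.0≤i⇒+∣i∣≡i (ℤP.i≤j⇒0≤j-i 1≤x)) (cong (_- 1ℤ) (sym (ℤP.0≤i⇒+∣i∣≡i (ℤP.≤-trans (ℤ.+≤+ ℕ.z≤n) 1≤x))))

+∣∣-suc : ∀ {x} → x < 0ℤ → + ∣ x + 1ℤ ∣ ≡ + ∣ x ∣ - 1ℤ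
+∣∣-suc {x} x<0 = begin
  + ∣ x + 1ℤ ∣        ≡⟨ cong (λ y → + ∣ y ∣) (ℤP.+-comm x 1ℤ) ⟩
  + ∣ 1ℤ + x ∣        ≡⟨ nonpos (ℤP.i<j⇒suc[i]≤j x<0) ⟩
  - (1ℤ + x)          ≡⟨ negate x ⟩
  - x - 1ℤ            ≡⟨ cong (_- 1ℤ) (sym (nonpos (ℤP.<⇒≤ x<0))) ⟩
  + ∣ x ∣ - 1ℤ        ∎
  where
  open ≡-Reasoning
  nonpos : ∀ {y} → y ≤ 0ℤ → + ∣ y ∣ ≡ - y
  nonpos {y} y≤0 = trans (cong +_ (sym (ℤP.∣-i∣≡∣i∣ y))) (ℤP.0≤i⇒+∣i∣≡i (ℤP.neg-mono-≤ y≤0))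
  negate : ∀ x → - (1ℤ + x) ≡ - x - 1ℤ
  negate = solve-∀

+∣∣-move : ∀ x a b → (a ≡ true → 1ℤ ≤ x) → (b ≡ true → x < 0ℤ) → + ∣ x - 𝟙 a + 𝟙 b ∣ ≡ + ∣ x ∣ - 𝟙 a - 𝟙 b
+∣∣-move x true  true  pos neg = contradiction (ℤP.<-≤-trans (neg refl) (ℤP.≤-trans (ℤ.+≤+ ℕ.z≤n) (pos refl))) (ℤP.<-irrefl refl)
+∣∣-move x true  false pos _   = begin
  + ∣ x - 1ℤ + 0ℤ ∣   ≡⟨ cong (λ y → + ∣ y ∣) (ℤP.+-identityʳ (x - 1ℤ)) ⟩
  + ∣ x - 1ℤ ∣        ≡⟨ +∣∣-pred (pos refl) ⟩
  + ∣ x ∣ - 1ℤ        ≡⟨ sym (ℤP.+-identityʳ (+ ∣ x ∣ - 1ℤ)) ⟩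
  + ∣ x ∣ - 1ℤ - 0ℤ   ∎
  where open ≡-Reasoning
+∣∣-move x false true  _   neg = begin
  + ∣ x - 0ℤ + 1ℤ ∣   ≡⟨ cong (λ y → + ∣ y + 1ℤ ∣) (ℤP.+-identityʳ x) ⟩
  + ∣ x + 1ℤ ∣        ≡⟨ +∣∣-suc (neg refl) ⟩
  + ∣ x ∣ - 1ℤ        ≡⟨ cong (_- 1ℤ) (sym (ℤP.+-identityʳ (+ ∣ x ∣))) ⟩
  + ∣ x ∣ - 0ℤ - 1ℤ   ∎
  where open ≡-Reasoning
+∣∣-move x false false _   _   = begin
  + ∣ x - 0ℤ + 0ℤ ∣   ≡⟨ cong (λ y → + ∣ y ∣) (trans (ℤP.+-identityʳ (x - 0ℤ)) (ℤP.+-identityʳ x)) ⟩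
  + ∣ x ∣             ≡⟨ sym (trans (ℤP.+-identityʳ (+ ∣ x ∣ - 0ℤ)) (ℤP.+-identityʳ (+ ∣ x ∣))) ⟩
  + ∣ x ∣ - 0ℤ - 0ℤ   ∎
  where open ≡-Reasoning

sub-share≤0 : ∀ k X Y Z → X ≤ 0ℤ → 0ℤ ≤ Z → + suc k * Y ≡ X + Z → X - Y ≤ 0ℤ
sub-share≤0 k X Y Z X≤0 0≤Z kY≡X+Z = ℤP.*-cancelˡ-≤-pos (X - Y) 0ℤ (+ suc k) (begin
  + suc k * (X - Y)          ≡⟨ expand (+ k) X Y ⟩
  + k * X + X - + suc k * Y  ≡⟨ cong (λ y → + k * X + X - y) kY≡X+Z ⟩
  + k * X + X - (X + Z)      ≡⟨ cancel (+ k) X Z ⟩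
  + k * X - Z                ≤⟨ ℤP.+-mono-≤ kX≤0 (ℤP.neg-mono-≤ 0≤Z) ⟩
  0ℤ                         ≡⟨ sym (ℤP.*-zeroʳ (+ suc k)) ⟩
  + suc k * 0ℤ               ∎)
  where
  open ℤP.≤-Reasoning
  kX≤0 : + k * X ≤ 0ℤ
  kX≤0 = subst (+ k * X ≤_) (ℤP.*-zeroʳ (+ k)) (ℤP.*-monoˡ-≤-nonNeg (+ k) X≤0)
  expand : ∀ k X Y → (1ℤ + k) * (X - Y) ≡ k * X + X - (1ℤ + k) * Y
  expand = solve-∀
  cancel : ∀ k X Z → k * X + X - (X + Z) ≡ k * X - Z
  cancel = solve-∀

module NetDegree (G : Graph) where

  incidence : Orientation G → E G → V G → ℤ
  incidence D e v = δ (tail G D e) v - δ (head G D e) v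

  divergence : Orientation G → (E G → ℤ) → V G → ℤ
  divergence D w v = ∑[ e < m G ] (w e * incidence D e v)

  net : Orientation G → (E G → Bool) → V G → ℤ
  net D S = divergence D (λ e → 𝟙 (S e))

  Balanced : Orientation G → (E G → Bool) → Set
  Balanced D X = ∀ v → net D X v ≡ 0ℤ

  netDeg≡net : ∀ D S v → netDeg G D S v ≡ net D S v
  netDeg≡net D S v = begin
    + outDeg G D S v - + inDeg G D S v
      ≡⟨ cong₂ _-_ (count≡∑ (λ e → ⌊ tail G D e ≟ v ⌋ ∧ S e)) (count≡∑ (λ e → ⌊ head G D e ≟ v ⌋ ∧ S e)) ⟩
    ∑[ e < m G ] 𝟙 (⌊ tail G D e ≟ v ⌋ ∧ S e) - ∑[ e < m G ] 𝟙 (⌊ head G D e ≟ v ⌋ ∧ S e)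
      ≡⟨ sym (∑-distrib-- {m G} (λ e → 𝟙 (⌊ tail G D e ≟ v ⌋ ∧ S e)) (λ e → 𝟙 (⌊ head G D e ≟ v ⌋ ∧ S e))) ⟩
    ∑[ e < m G ] (𝟙 (⌊ tail G D e ≟ v ⌋ ∧ S e) - 𝟙 (⌊ head G D e ≟ v ⌋ ∧ S e))
      ≡⟨ sum-cong-≗ edge ⟩
    net D S v ∎
    where
    open ≡-Reasoning
    𝟙-∧-≟ : ∀ a s → 𝟙 (⌊ a ≟ v ⌋ ∧ s) ≡ 𝟙 s * δ a v
    𝟙-∧-≟ a s = begin
      𝟙 (⌊ a ≟ v ⌋ ∧ s)   ≡⟨ 𝟙-∧ ⌊ a ≟ v ⌋ s ⟩
      𝟙 ⌊ a ≟ v ⌋ * 𝟙 s   ≡⟨ cong (λ b → 𝟙 b * 𝟙 s) (isYes≗does (a ≟ v)) ⟩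
      δ a v * 𝟙 s         ≡⟨ ℤP.*-comm (δ a v) (𝟙 s) ⟩
      𝟙 s * δ a v         ∎
    distrib : ∀ a x y → a * x - a * y ≡ a * (x - y)
    distrib = solve-∀
    edge : ∀ e → 𝟙 (⌊ tail G D e ≟ v ⌋ ∧ S e) - 𝟙 (⌊ head G D e ≟ v ⌋ ∧ S e) ≡ 𝟙 (S e) * incidence D e v
    edge e = trans (cong₂ _-_ (𝟙-∧-≟ (tail G D e) (S e)) (𝟙-∧-≟ (head G D e) (S e)))
                   (distrib (𝟙 (S e)) (δ (tail G D e) v) (δ (head G D e) v))

  divergence-cong : ∀ D {w w′} → (∀ e → w e ≡ w′ e) → ∀ v → divergence D w v ≡ divergence D w′ v
  divergence-cong D w≗w′ v = sum-cong-≗ (λ e → cong (_* incidence D e v) (w≗w′ e))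

  net-cong : ∀ D {S S′} → (∀ e → S e ≡ S′ e) → ∀ v → net D S v ≡ net D S′ v
  net-cong D S≗S′ = divergence-cong D (λ e → cong 𝟙 (S≗S′ e))

  divergence-+ : ∀ D w w′ v → divergence D (λ e → w e + w′ e) v ≡ divergence D w v + divergence D w′ v
  divergence-+ D w w′ v =
    trans (sum-cong-≗ (λ e → ℤP.*-distribʳ-+ (incidence D e v) (w e) (w′ e)))
          (∑-distrib-+ (λ e → w e * incidence D e v) (λ e → w′ e * incidence D e v))

  divergence-- : ∀ D w w′ v → divergence D (λ e → w e - w′ e) v ≡ divergence D w v - divergence D w′ v
  divergence-- D w w′ v =
    trans (sum-cong-≗ (λ e → distrib (w e) (w′ e) (incidence D e v)))
          (∑-distrib-- (λ e → w e * incidence D e v) (λ e → w′ e * incidence D e v))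
    where
    distrib : ∀ a b x → (a - b) * x ≡ a * x - b * x
    distrib = solve-∀

  net-∖ : ∀ D {H S} → S ⊆ H → ∀ v → net D (λ e → H e ∧ not (S e)) v ≡ net D H v - net D S v
  net-∖ D {H} {S} S⊆H v =
    trans (divergence-cong D (λ e → 𝟙-∖ (S⊆H e)) v) (divergence-- D (λ e → 𝟙 (H e)) (λ e → 𝟙 (S e)) v)

  ∑-weighted-divergence : ∀ D w (r : V G → ℤ) →
    ∑[ v < n G ] (r v * divergence D w v) ≡ ∑[ e < m G ] (w e * (r (tail G D e) - r (head G D e)))
  ∑-weighted-divergence D w r = begin
    ∑[ v < n G ] (r v * ∑[ e < m G ] (w e * incidence D e v))
      ≡⟨ sum-cong-≗ (λ v → *-distribˡ-sum (r v) (λ e → w e * incidence D e v)) ⟩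
    ∑[ v < n G ] ∑[ e < m G ] (r v * (w e * incidence D e v))
      ≡⟨ ∑-comm (λ v e → r v * (w e * incidence D e v)) ⟩
    ∑[ e < m G ] ∑[ v < n G ] (r v * (w e * incidence D e v))
      ≡⟨ sum-cong-≗ edge ⟩
    ∑[ e < m G ] (w e * (r (tail G D e) - r (head G D e))) ∎
    where
    open ≡-Reasoning
    regroup : ∀ r w a b → r * (w * (a - b)) ≡ w * (a * r - b * r)
    regroup = solve-∀
    edge : ∀ e → ∑[ v < n G ] (r v * (w e * incidence D e v)) ≡ w e * (r (tail G D e) - r (head G D e))
    edge e = let t = tail G D e ; h = head G D e in begin
      ∑[ v < n G ] (r v * (w e * incidence D e v))
        ≡⟨ sum-cong-≗ (λ v → regroup (r v) (w e) (δ t v) (δ h v)) ⟩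
      ∑[ v < n G ] (w e * (δ t v * r v - δ h v * r v))
        ≡⟨ sym (*-distribˡ-sum (w e) (λ v → δ t v * r v - δ h v * r v)) ⟩
      w e * ∑[ v < n G ] (δ t v * r v - δ h v * r v)
        ≡⟨ cong (w e *_) (trans (∑-distrib-- (λ v → δ t v * r v) (λ v → δ h v * r v)) (cong₂ _-_ (∑-δ t r) (∑-δ h r))) ⟩
      w e * (r t - r h) ∎

  ∑-divergence : ∀ D w → ∑[ v < n G ] divergence D w v ≡ 0ℤ
  ∑-divergence D w = begin
    ∑[ v < n G ] divergence D w v            ≡⟨ sum-cong-≗ (λ v → sym (ℤP.*-identityˡ (divergence D w v))) ⟩
    ∑[ v < n G ] (1ℤ * divergence D w v)     ≡⟨ ∑-weighted-divergence D w (λ _ → 1ℤ) ⟩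
    ∑[ e < m G ] (w e * (1ℤ - 1ℤ))           ≡⟨ sum-cong-≗ (λ e → ℤP.*-zeroʳ (w e)) ⟩
    ∑[ e < m G ] 0ℤ                          ≡⟨ ∑-zero {m G} ⟩
    0ℤ                                       ∎
    where open ≡-Reasoning

  net-partition : ∀ {ℓ} D (part : E G → Fin ℓ) v →
    ∑[ i < ℓ ] net D (inClass {G} part i) v ≡ net D (λ _ → true) v
  net-partition {ℓ} D part v = begin
    ∑[ i < ℓ ] ∑[ e < m G ] (𝟙 ⌊ part e ≟ i ⌋ * incidence D e v)
      ≡⟨ ∑-comm (λ i e → 𝟙 ⌊ part e ≟ i ⌋ * incidence D e v) ⟩
    ∑[ e < m G ] ∑[ i < ℓ ] (𝟙 ⌊ part e ≟ i ⌋ * incidence D e v)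
      ≡⟨ sum-cong-≗ (λ e → trans (sum-cong-≗ (λ i → cong (λ b → 𝟙 b * incidence D e v) (isYes≗does (part e ≟ i))))
                                 (∑-δ (part e) (λ _ → incidence D e v))) ⟩
    ∑[ e < m G ] incidence D e v
      ≡⟨ sum-cong-≗ (λ e → sym (ℤP.*-identityˡ (incidence D e v))) ⟩
    net D (λ _ → true) v ∎
    where open ≡-Reasoning

  incidence-cong : ∀ {D₁ D₂} e → D₁ e ≡ D₂ e → ∀ v → incidence D₁ e v ≡ incidence D₂ e v
  incidence-cong e D₁e≡D₂e v = cong (λ b → δ (tailOf b) v - δ (headOf b) v) D₁e≡D₂e
    where
    tailOf headOf : Bool → V G
    tailOf b = if b then proj₁ (ends G e) else proj₂ (ends G e)
    headOf b = if b then proj₂ (ends G e) else proj₁ (ends G e)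

  tail≢head : ∀ D e → tail G D e ≢ head G D e
  tail≢head D e with D e
  ... | true  = loopless G e
  ... | false = λ t≡h → loopless G e (sym t≡h)

  reverseOn : (E G → Bool) → Orientation G → Orientation G
  reverseOn C D e = if C e then not (D e) else D e

  module _ (C : E G → Bool) (D : Orientation G) (e : E G) where

    reverseOn-ends : C e ≡ true → tail G (reverseOn C D) e ≡ head G D e × head G (reverseOn C D) e ≡ tail G D e
    reverseOn-ends Ce rewrite Ce with D e
    ... | true  = refl , refl
    ... | false = refl , refl

    reverseOn-kept : C e ≡ false → tail G (reverseOn C D) e ≡ tail G D e × head G (reverseOn C D) e ≡ head G D e
    reverseOn-kept Ce rewrite Ce = refl , refl

    incidence-reverseOn : ∀ v → C e ≡ true → incidence (reverseOn C D) e v ≡ - incidence D e v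
    incidence-reverseOn v Ce = trans (cong₂ (λ x y → δ x v - δ y v) t≡h h≡t) (swap (δ (tail G D e) v) (δ (head G D e) v))
      where
      t≡h = proj₁ (reverseOn-ends Ce)
      h≡t = proj₂ (reverseOn-ends Ce)
      swap : ∀ a b → b - a ≡ - (a - b)
      swap = solve-∀

module Cycles (G : Graph) where
  open NetDegree G

  DirectedCycle : Orientation G → Cycle G → Set
  DirectedCycle D C = ∀ i → tail G D (es i) ≡ vs i × head G D (es i) ≡ vs (next i)
    where open Cycle C

  cycleEdges : Cycle G → E G → Bool
  cycleEdges C = inImage (Cycle.es C)

  cycleEdges-⊆ : ∀ C {X : E G → Bool} → (∀ i → X (Cycle.es C i) ≡ true) → cycleEdges C ⊆ X
  cycleEdges-⊆ C C⊆X e onC with dec-true⁻¹ (any? (λ i → Cycle.es C i ≟ e)) onC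
  ... | i , refl = C⊆X i

  directedCycle-balanced : ∀ D C → DirectedCycle D C → Balanced D (cycleEdges C)
  directedCycle-balanced D C directed v = begin
    ∑[ e < m G ] (𝟙 (inImage es e) * incidence D e v)
      ≡⟨ ∑-image es-inj (λ e → incidence D e v) ⟩
    ∑[ r < L ] incidence D (es r) v
      ≡⟨ sum-cong-≗ (λ r → cong₂ (λ x y → δ x v - δ y v) (proj₁ (directed r)) (proj₂ (directed r))) ⟩
    ∑[ r < L ] (δ (vs r) v - δ (vs (next r)) v)
      ≡⟨ ∑-distrib-- (λ r → δ (vs r) v) (λ r → δ (vs (next r)) v) ⟩
    ∑[ r < L ] δ (vs r) v - ∑[ r < L ] δ (vs (next r)) v
      ≡⟨ cong₂ _-_ (∑-δ-image vs-inj v) (∑-δ-image (λ p → next-injective (vs-inj p)) v) ⟩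
    𝟙 (inImage vs v) - 𝟙 (inImage (λ r → vs (next r)) v)
      ≡⟨ cong (λ b → 𝟙 (inImage vs v) - 𝟙 b) image-shift ⟩
    𝟙 (inImage vs v) - 𝟙 (inImage vs v)
      ≡⟨ ℤP.+-inverseʳ (𝟙 (inImage vs v)) ⟩
    0ℤ ∎
    where
    open Cycle C
    open ≡-Reasoning
    L = suc (suc k)
    image-shift : inImage (λ r → vs (next r)) v ≡ inImage vs v
    image-shift = does-⇔ (mk⇔ (λ { (r , p) → next r , p }) preimage)
                         (any? (λ r → vs (next r) ≟ v)) (any? (λ r → vs r ≟ v))
      where
      preimage : (∃ λ r → vs r ≡ v) → ∃ λ r → vs (next r) ≡ v
      preimage (r , p) = let r′ , next-r′≡r = next-surjective r in r′ , trans (cong vs next-r′≡r) p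

  joins-oriented : ∀ D e → Joins G e (tail G D e) (head G D e)
  joins-oriented D e with D e
  ... | true  = inj₁ (refl , refl)
  ... | false = inj₂ (refl , refl)

  module _ (D : Orientation G) {X : E G → Bool} (balanced : Balanced D X) where

    Leaves : V G → Set
    Leaves v = ∃ λ e → X e ≡ true × tail G D e ≡ v

    leaves? : ∀ v → Dec (Leaves v)
    leaves? v = any? (λ e → (X e Bool.≟ true) ×-dec (tail G D e ≟ v))

    entered⇒leaves : ∀ {e₁ v} → X e₁ ≡ true → head G D e₁ ≡ v → Leaves v
    entered⇒leaves {e₁} {v} Xe₁ head≡v with leaves? v
    ... | yes leaves = leaves
    ... | no ¬leaves = contradiction (∑-nonpos-≡0 term≤0 (balanced v) e₁) term₁≢0
      where
      δ-tail : ∀ {e} → X e ≡ true → δ (tail G D e) v ≡ 0ℤ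
      δ-tail Xe = δ-≢ (λ tail≡v → ¬leaves (_ , Xe , tail≡v))
      entering≤0 : ∀ x → 0ℤ ≤ x → 1ℤ * (0ℤ - x) ≤ 0ℤ
      entering≤0 x 0≤x = subst (_≤ 0ℤ) (sym (trans (ℤP.*-identityˡ (0ℤ - x)) (ℤP.+-identityˡ (- x)))) (ℤP.neg-mono-≤ 0≤x)
      term≤0 : ∀ e → 𝟙 (X e) * incidence D e v ≤ 0ℤ
      term≤0 e with X e in Xe
      ... | false = ℤP.≤-refl
      ... | true rewrite δ-tail Xe = entering≤0 (δ (head G D e) v) (𝟙-nonneg (does (head G D e ≟ v)))
      term₁≢0 : 𝟙 (X e₁) * incidence D e₁ v ≢ 0ℤ
      term₁≢0 rewrite Xe₁ | δ-tail Xe₁ | head≡v | δ-refl v = λ ()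

    module Walk {e₀ : E G} (Xe₀ : X e₀ ≡ true) where

      exit : V G → E G
      exit v with leaves? v
      ... | yes (e , _) = e
      ... | no _        = e₀

      exit-spec : ∀ {v} → Leaves v → X (exit v) ≡ true × tail G D (exit v) ≡ v
      exit-spec {v} leaves with leaves? v
      ... | yes (_ , spec) = spec
      ... | no ¬leaves     = contradiction leaves ¬leaves

      walk : ℕ → V G
      walk zero    = tail G D e₀
      walk (suc t) = head G D (exit (walk t))

      walk-leaves : ∀ t → Leaves (walk t)
      walk-leaves zero    = e₀ , Xe₀ , refl
      walk-leaves (suc t) = entered⇒leaves (proj₁ (exit-spec (walk-leaves t))) refl

      closedWalk⇒cycle : ∀ a k → walk (suc (a ℕ.+ suc k)) ≡ walk a →
                         (∀ {p q} → p ℕ.< q → q ℕ.< suc (a ℕ.+ suc k) → walk p ≢ walk q) →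
                         Σ (Cycle G) λ C → DirectedCycle D C × (∀ i → X (Cycle.es C i) ≡ true)
      closedWalk⇒cycle a k closes distinct =
        C , (λ r → tail-es r , head-es r) , (λ r → proj₁ (exit-spec (walk-leaves (a ℕ.+ toℕ r))))
        where
        vs : Fin (suc (suc k)) → V G
        vs r = walk (a ℕ.+ toℕ r)
        es : Fin (suc (suc k)) → E G
        es r = exit (vs r)
        index< : ∀ r → a ℕ.+ toℕ r ℕ.< suc (a ℕ.+ suc k)
        index< r = subst (a ℕ.+ toℕ r ℕ.<_) (ℕP.+-suc a (suc k)) (ℕP.+-monoʳ-< a (FinP.toℕ<n r))
        vs-inj : Injective _≡_ _≡_ vs
        vs-inj {r} {r′} vs≡ with ℕP.<-cmp (toℕ r) (toℕ r′)
        ... | tri< r<r′ _ _ = contradiction vs≡ (distinct (ℕP.+-monoʳ-< a r<r′) (index< r′))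
        ... | tri≈ _ r≡r′ _ = FinP.toℕ-injective r≡r′
        ... | tri> _ _ r′<r = contradiction (sym vs≡) (distinct (ℕP.+-monoʳ-< a r′<r) (index< r))
        tail-es : ∀ r → tail G D (es r) ≡ vs r
        tail-es r = proj₂ (exit-spec (walk-leaves (a ℕ.+ toℕ r)))
        head-es : ∀ r → head G D (es r) ≡ vs (next r)
        head-es r with next-cases r
        ... | inj₁ (r≡last , next≡0) = begin
          walk (suc (a ℕ.+ toℕ r))      ≡⟨ cong (λ x → walk (suc (a ℕ.+ x))) r≡last ⟩
          walk (suc (a ℕ.+ suc k))      ≡⟨ closes ⟩
          walk a                        ≡⟨ cong walk (sym (ℕP.+-identityʳ a)) ⟩
          walk (a ℕ.+ toℕ (zero {suc k})) ≡⟨ cong vs (sym next≡0) ⟩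
          vs (next r)                   ∎
          where open ≡-Reasoning

        ... | inj₂ next≡suc          = cong walk (trans (sym (ℕP.+-suc a (toℕ r))) (cong (a ℕ.+_) (sym next≡suc)))
        es-inj : Injective _≡_ _≡_ es
        es-inj {r} {r′} es≡ = vs-inj (trans (sym (tail-es r)) (trans (cong (tail G D) es≡) (tail-es r′)))
        C : Cycle G
        C = record { k = k ; vs = vs ; es = es ; vs-inj = vs-inj ; es-inj = es-inj
                   ; joins = λ r → subst₂ (Joins G (es r)) (tail-es r) (head-es r) (joins-oriented D (es r)) }

      directedCycle : Σ (Cycle G) λ C → DirectedCycle D C × (∀ i → X (Cycle.es C i) ≡ true)
      directedCycle with first-repetition walk
      ... | record { start = a ; start<end = a<b ; closes = closes ; distinct = distinct } with ℕP.m≤n⇒∃[o]m+o≡n a<b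
      ... | zero  , refl = contradiction loop (tail≢head D (exit (walk a)))
        where
        loop : tail G D (exit (walk a)) ≡ head G D (exit (walk a))
        loop = trans (proj₂ (exit-spec (walk-leaves a)))
                     (sym (trans (cong (λ x → walk (suc x)) (sym (ℕP.+-identityʳ a))) closes))
      ... | suc k , refl = closedWalk⇒cycle a k closes distinct

    balanced⇒directedCycle : ∀ {e₀} → X e₀ ≡ true →
                             Σ (Cycle G) λ C → DirectedCycle D C × (∀ i → X (Cycle.es C i) ≡ true)
    balanced⇒directedCycle Xe₀ = Walk.directedCycle Xe₀

  disagree : Signature G → Signature G → E G → Bool
  disagree τ τ′ e = isPos (τ e) xor isPos (τ′ e)

  inverseOn : Cycle G → Signature G → Signature G
  inverseOn C τ e = if cycleEdges C e then flipSign (τ e) else τ e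

  inverseOn-step : ∀ C τ → InvStep G τ (inverseOn C τ)
  inverseOn-step C τ = C , λ e → on e , off e
    where
    on : ∀ e → e ∈C C → inverseOn C τ e ≡ flipSign (τ e)
    on e e∈C with cycleEdges C e in onC
    ... | true  = refl
    ... | false = contradiction e∈C (dec-false⁻¹ (any? (λ i → Cycle.es C i ≟ e)) onC)
    off : ∀ e → ¬ (e ∈C C) → inverseOn C τ e ≡ τ e
    off e e∉C with cycleEdges C e in onC
    ... | true  = contradiction (dec-true⁻¹ (any? (λ i → Cycle.es C i ≟ e)) onC) e∉C
    ... | false = refl

  disagree-inverseOn : ∀ C τ τ′ → cycleEdges C ⊆ disagree τ τ′ →
    ∀ e → disagree (inverseOn C τ) τ′ e ≡ disagree τ τ′ e ∧ not (cycleEdges C e)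
  disagree-inverseOn C τ τ′ C⊆X e with cycleEdges C e in onC
  ... | false = sym (Bool.∧-identityʳ (disagree τ τ′ e))
  ... | true  = trans (flip-disagreement (τ e) (τ′ e) (C⊆X e onC)) (sym (Bool.∧-zeroʳ (disagree τ τ′ e)))
    where
    flip-disagreement : ∀ s t → isPos s xor isPos t ≡ true → isPos (flipSign s) xor isPos t ≡ false
    flip-disagreement ⊕ ⊖ _ = refl
    flip-disagreement ⊖ ⊕ _ = refl

  agree⇒≡ : ∀ s t → isPos s xor isPos t ≡ false → s ≡ t
  agree⇒≡ ⊕ ⊕ _ = refl
  agree⇒≡ ⊖ ⊖ _ = refl

  #disagree : Signature G → Signature G → ℤ
  #disagree τ τ′ = ∑[ e < m G ] 𝟙 (disagree τ τ′ e)

  module _ (D : Orientation G) (τ τ′ : Signature G) (C : Cycle G) (directed : DirectedCycle D C)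
           (C⊆X : cycleEdges C ⊆ disagree τ τ′) where

    private
      𝟙-disagree-inverseOn : ∀ e → 𝟙 (disagree (inverseOn C τ) τ′ e) ≡ 𝟙 (disagree τ τ′ e) - 𝟙 (cycleEdges C e)
      𝟙-disagree-inverseOn e = trans (cong 𝟙 (disagree-inverseOn C τ τ′ C⊆X e)) (𝟙-∖ (C⊆X e))

    inverseOn-balanced : Balanced D (disagree τ τ′) → Balanced D (disagree (inverseOn C τ) τ′)
    inverseOn-balanced balanced v = begin
      net D (disagree (inverseOn C τ) τ′) v                     ≡⟨ divergence-cong D 𝟙-disagree-inverseOn v ⟩
      divergence D (λ e → 𝟙 (disagree τ τ′ e) - 𝟙 (cycleEdges C e)) v
        ≡⟨ divergence-- D (λ e → 𝟙 (disagree τ τ′ e)) (λ e → 𝟙 (cycleEdges C e)) v ⟩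
      net D (disagree τ τ′) v - net D (cycleEdges C) v
        ≡⟨ cong₂ _-_ (balanced v) (directedCycle-balanced D C directed v) ⟩
      0ℤ                                                        ∎
      where open ≡-Reasoning

    inverseOn-decreases : #disagree (inverseOn C τ) τ′ < #disagree τ τ′
    inverseOn-decreases = ℤP.suc[i]≤j⇒i<j (begin
      1ℤ + #disagree (inverseOn C τ) τ′    ≡⟨ ℤP.+-comm 1ℤ (#disagree (inverseOn C τ) τ′) ⟩
      #disagree (inverseOn C τ) τ′ ℤ.+ 1ℤ  ≡⟨ cong (ℤ._+ 1ℤ) shrinks ⟩
      #disagree τ τ′ - #C ℤ.+ 1ℤ           ≤⟨ ℤP.+-monoʳ-≤ (#disagree τ τ′ - #C) nonempty ⟩
      #disagree τ τ′ - #C ℤ.+ #C           ≡⟨ cancel (#disagree τ τ′) #C ⟩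
      #disagree τ τ′                       ∎)
      where
      open ℤP.≤-Reasoning
      #C = ∑[ e < m G ] 𝟙 (cycleEdges C e)
      shrinks : #disagree (inverseOn C τ) τ′ ≡ #disagree τ τ′ - #C
      shrinks = trans (sum-cong-≗ 𝟙-disagree-inverseOn) (∑-distrib-- (λ e → 𝟙 (disagree τ τ′ e)) (λ e → 𝟙 (cycleEdges C e)))
      nonempty : 1ℤ ≤ #C
      nonempty = subst (_≤ #C) (cong 𝟙 (dec-true (any? (λ i → Cycle.es C i ≟ Cycle.es C zero)) (zero , refl)))
                       (∑-term-≤ (λ e → 𝟙-nonneg (cycleEdges C e)) (Cycle.es C zero))
      cancel : ∀ x c → x - c ℤ.+ c ≡ x
      cancel = solve-∀

  balanced⇒invEquiv : ∀ D τ τ′ → Balanced D (disagree τ τ′) → ∃ λ τ″ → InvEquiv G τ τ″ × (∀ e → τ″ e ≡ τ′ e)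
  balanced⇒invEquiv D τ τ′ balanced =
    go _ τ balanced (ℤP.≤-reflexive (sym (ℤP.0≤i⇒+∣i∣≡i (∑-nonneg (λ e → 𝟙-nonneg (disagree τ τ′ e))))))
    where
    Result : Signature G → Set
    Result τ = ∃ λ τ″ → InvEquiv G τ τ″ × (∀ e → τ″ e ≡ τ′ e)
    agreement : ∀ τ → ¬ (∃ λ e → disagree τ τ′ e ≡ true) → Result τ
    agreement τ none = τ , ε , λ e → agree⇒≡ (τ e) (τ′ e) (Bool.¬-not (λ d → none (e , d)))
    go : ∀ fuel τ → Balanced D (disagree τ τ′) → #disagree τ τ′ ≤ + fuel → Result τ
    go fuel τ balanced bound with any? (λ e → disagree τ τ′ e Bool.≟ true)
    ... | no none = agreement τ none
    go zero τ balanced bound | yes (e₀ , d₀) =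
      contradiction (ℤP.≤-trans (subst (_≤ #disagree τ τ′) (cong 𝟙 d₀) (∑-term-≤ (λ e → 𝟙-nonneg (disagree τ τ′ e)) e₀)) bound)
                    λ { (ℤ.+≤+ ()) }
    go (suc fuel) τ balanced bound | yes (e₀ , d₀) = invert (balanced⇒directedCycle D {disagree τ τ′} balanced d₀)
      where
      invert : (Σ (Cycle G) λ C → DirectedCycle D C × (∀ i → disagree τ τ′ (Cycle.es C i) ≡ true)) → Result τ
      invert (C , directed , C⊆X) =
        let τ″ , chain , agree = go fuel (inverseOn C τ) (inverseOn-balanced D τ τ′ C directed onC⊆X balanced)
                                    (ℤP.i<j⇒i≤pred[j] (ℤP.<-≤-trans (inverseOn-decreases D τ τ′ C directed onC⊆X) bound))
        in τ″ , inverseOn-step C τ ◅ chain , agree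
        where onC⊆X = cycleEdges-⊆ C C⊆X

module Splitting (G : Graph) where
  open NetDegree G

  module _ (D : Orientation G) where

    residual : (E G → Bool) → Orientation G
    residual S = reverseOn (λ e → not (S e)) D

    toggle : E G → (E G → Bool) → E G → Bool
    toggle e₀ S e = if does (e₀ ≟ e) then not (S e) else S e

    net-toggle : ∀ e₀ S v → net D (toggle e₀ S) v ≡ net D S v - incidence (residual S) e₀ v
    net-toggle e₀ S v = begin
      net D (toggle e₀ S) v
        ≡⟨ divergence-cong D 𝟙-toggle v ⟩
      divergence D (λ e → 𝟙 (S e) + δ e₀ e * change) v
        ≡⟨ divergence-+ D (λ e → 𝟙 (S e)) (λ e → δ e₀ e * change) v ⟩
      net D S v + ∑[ e < m G ] (δ e₀ e * change * incidence D e v)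
        ≡⟨ cong (λ x → net D S v + x) (trans (sum-cong-≗ (λ e → ℤP.*-assoc (δ e₀ e) change (incidence D e v)))
                                             (∑-δ e₀ (λ e → change * incidence D e v))) ⟩
      net D S v + change * incidence D e₀ v
        ≡⟨ cong (λ x → net D S v + x) change-residual ⟩
      net D S v - incidence (residual S) e₀ v ∎
      where
      open ≡-Reasoning
      change = 𝟙 (not (S e₀)) - 𝟙 (S e₀)
      𝟙-toggle : ∀ e → 𝟙 (toggle e₀ S e) ≡ 𝟙 (S e) + δ e₀ e * change
      𝟙-toggle e with e₀ ≟ e
      ... | no _     = sym (ℤP.+-identityʳ (𝟙 (S e)))
      ... | yes refl with S e₀
      ...   | true  = refl
      ...   | false = refl
      change-residual : change * incidence D e₀ v ≡ - incidence (residual S) e₀ v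
      change-residual with S e₀
      ... | true  = ℤP.-1*i≡-i (incidence D e₀ v)
      ... | false = trans (ℤP.*-identityˡ (incidence D e₀ v))
                          (trans (sym (ℤP.neg-involutive _)) (cong -_ (sym (incidence-reverseOn (λ _ → true) D e₀ v refl))))

    module Augmenting (H : E G → Bool) (f : V G → ℤ) (k : ℕ) (H≡kf : ∀ v → net D H v ≡ + suc k * f v) where

      excess : (E G → Bool) → V G → ℤ
      excess S v = net D S v - f v

      ∑f≡0 : ∑[ v < n G ] f v ≡ 0ℤ
      ∑f≡0 = ℤP.*-cancelˡ-≡ (+ suc k) (sum f) 0ℤ (begin
        + suc k * sum f                  ≡⟨ *-distribˡ-sum (+ suc k) f ⟩
        ∑[ v < n G ] (+ suc k * f v)     ≡⟨ sum-cong-≗ (λ v → sym (H≡kf v)) ⟩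
        ∑[ v < n G ] net D H v           ≡⟨ ∑-divergence D (λ e → 𝟙 (H e)) ⟩
        0ℤ                               ≡⟨ sym (ℤP.*-zeroʳ (+ suc k)) ⟩
        + suc k * 0ℤ                     ∎)
        where open ≡-Reasoning

      ∑-excess : ∀ S → ∑[ v < n G ] excess S v ≡ 0ℤ
      ∑-excess S = trans (∑-distrib-- (net D S) f) (cong₂ _-_ (∑-divergence D (λ e → 𝟙 (S e))) ∑f≡0)

      ResidualClosed : (E G → Bool) → (V G → Bool) → Set
      ResidualClosed S R = ∀ e → H e ≡ true → R (tail G (residual S) e) ≡ true → R (head G (residual S) e) ≡ true

      -- Net degree leaves a residually closed set R only along edges of S and enters it only
      -- along the other edges of H; as (k+1)·∑_R f = ∑_R net H, the excess of S on R is ≤ 0.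
      closed⇒excess≤0 : ∀ {S R} → S ⊆ H → ResidualClosed S R → ∑[ v < n G ] (𝟙 (R v) * excess S v) ≤ 0ℤ
      closed⇒excess≤0 {S} {R} S⊆H closed = subst (_≤ 0ℤ) (sym W≡X-Y) (sub-share≤0 k X Y Z X≤0 0≤Z kY≡X+Z)
        where
        r : V G → ℤ
        r v = 𝟙 (R v)
        d : E G → ℤ
        d e = r (tail G D e) - r (head G D e)
        X = ∑[ e < m G ] (𝟙 (S e) * d e)
        Z = ∑[ e < m G ] (𝟙 (H e ∧ not (S e)) * d e)
        Y = ∑[ v < n G ] (r v * f v)
        Reached : V G → Set
        Reached x = R x ≡ true
        X≤0 : X ≤ 0ℤ
        X≤0 = ∑-nonpos term
          where
          term : ∀ e → 𝟙 (S e) * d e ≤ 0ℤ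
          term e with S e in Se
          ... | false = ℤP.≤-refl
          ... | true  = subst (_≤ 0ℤ) (sym (ℤP.*-identityˡ (d e))) (ℤP.i≤j⇒i-j≤0 (𝟙-mono forward))
            where
            forward : Reached (tail G D e) → Reached (head G D e)
            forward Rt = let t≡ , h≡ = reverseOn-kept (λ e → not (S e)) D e (cong not Se) in
              subst Reached h≡ (closed e (S⊆H e Se) (subst Reached (sym t≡) Rt))
        0≤Z : 0ℤ ≤ Z
        0≤Z = ∑-nonneg term
          where
          term : ∀ e → 0ℤ ≤ 𝟙 (H e ∧ not (S e)) * d e
          term e with H e in He | S e in Se
          ... | false | _     = ℤP.≤-refl
          ... | true  | true  = ℤP.≤-refl
          ... | true  | false = subst (0ℤ ≤_) (sym (ℤP.*-identityˡ (d e))) (ℤP.i≤j⇒0≤j-i (𝟙-mono backward))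
            where
            backward : Reached (head G D e) → Reached (tail G D e)
            backward Rh = let t≡ , h≡ = reverseOn-ends (λ e → not (S e)) D e (cong not Se) in
              subst Reached h≡ (closed e He (subst Reached (sym t≡) Rh))
        kY≡X+Z : + suc k * Y ≡ X + Z
        kY≡X+Z = begin
          + suc k * Y
            ≡⟨ *-distribˡ-sum (+ suc k) (λ v → r v * f v) ⟩
          ∑[ v < n G ] (+ suc k * (r v * f v))
            ≡⟨ sum-cong-≗ (λ v → trans (swap (+ suc k) (r v) (f v)) (cong (r v *_) (sym (H≡kf v)))) ⟩
          ∑[ v < n G ] (r v * net D H v)
            ≡⟨ ∑-weighted-divergence D (λ e → 𝟙 (H e)) r ⟩
          ∑[ e < m G ] (𝟙 (H e) * d e)
            ≡⟨ sum-cong-≗ (λ e → trans (cong (_* d e) (split e)) (ℤP.*-distribʳ-+ (d e) (𝟙 (S e)) _)) ⟩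
          ∑[ e < m G ] (𝟙 (S e) * d e + 𝟙 (H e ∧ not (S e)) * d e)
            ≡⟨ ∑-distrib-+ (λ e → 𝟙 (S e) * d e) (λ e → 𝟙 (H e ∧ not (S e)) * d e) ⟩
          X + Z ∎
          where
          open ≡-Reasoning
          swap : ∀ c a b → c * (a * b) ≡ a * (c * b)
          swap = solve-∀
          rearrange : ∀ a b → a ≡ b + (a - b)
          rearrange = solve-∀
          split : ∀ e → 𝟙 (H e) ≡ 𝟙 (S e) + 𝟙 (H e ∧ not (S e))
          split e = trans (rearrange (𝟙 (H e)) (𝟙 (S e))) (cong (λ x → 𝟙 (S e) + x) (sym (𝟙-∖ (S⊆H e))))
        W≡X-Y : ∑[ v < n G ] (r v * excess S v) ≡ X - Y
        W≡X-Y = begin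
          ∑[ v < n G ] (r v * (net D S v - f v))        ≡⟨ sum-cong-≗ (λ v → distrib (r v) (net D S v) (f v)) ⟩
          ∑[ v < n G ] (r v * net D S v - r v * f v)    ≡⟨ ∑-distrib-- (λ v → r v * net D S v) (λ v → r v * f v) ⟩
          ∑[ v < n G ] (r v * net D S v) - Y            ≡⟨ cong (_- Y) (∑-weighted-divergence D (λ e → 𝟙 (S e)) r) ⟩
          X - Y                                          ∎
          where
          open ≡-Reasoning
          distrib : ∀ a b c → a * (b - c) ≡ a * b - a * c
          distrib = solve-∀

      record Shift (S : E G → Bool) (v₀ u : V G) : Set where
        field
          S′     : E G → Bool
          S′⊆H   : S′ ⊆ H
          net-S′ : ∀ v → net D S′ v ≡ net D S v - δ v₀ v + δ u v

      module Search {S : E G → Bool} (S⊆H : S ⊆ H) (v₀ : V G) where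

        reach : ℕ → V G → Bool
        reach zero    u = does (v₀ ≟ u)
        reach (suc t) u = reach t u ∨ anyᵇ (λ e → H e ∧ reach t (tail G (residual S) e) ∧ does (head G (residual S) e ≟ u))

        reach-mono : ∀ t u → reach t u ≡ true → reach (suc t) u ≡ true
        reach-mono t u Rtu rewrite Rtu = refl

        reach-v₀ : ∀ t → reach t v₀ ≡ true
        reach-v₀ zero    = dec-true (v₀ ≟ v₀) refl
        reach-v₀ (suc t) = reach-mono t v₀ (reach-v₀ t)

        Stable : ℕ → Set
        Stable t = ∀ u → reach (suc t) u ≡ reach t u

        #reach : ℕ → ℤ
        #reach t = ∑[ u < n G ] 𝟙 (reach t u)

        unstable-grows : ∀ t → ¬ Stable t → #reach t < #reach (suc t)
        unstable-grows t ¬stable with FinP.¬∀⟶∃¬ (n G) _ (λ u → reach (suc t) u Bool.≟ reach t u) ¬stable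
        ... | u , new = ∑-mono-< (λ u → 𝟙-mono (reach-mono t u)) u (newly-reached (reach-mono t u) new)
          where
          newly-reached : ∀ {a b} → (a ≡ true → b ≡ true) → b ≢ a → 𝟙 a < 𝟙 b
          newly-reached {false} {true}  _   _   = ℤ.+<+ (ℕ.s≤s ℕ.z≤n)
          newly-reached {true}  {true}  _   b≢a = contradiction refl b≢a
          newly-reached {false} {false} _   b≢a = contradiction refl b≢a
          newly-reached {true}  {false} a⇒b _   = case a⇒b refl of λ ()

        growth : ∀ t → ∃ Stable ⊎ + suc t ≤ #reach t
        growth zero = inj₂ (ℤP.≤-reflexive (sym (∑-δ₁ v₀)))
        growth (suc t) with growth t
        ... | inj₁ stable = inj₁ stable
        ... | inj₂ big with FinP.all? (λ u → reach (suc t) u Bool.≟ reach t u)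
        ...   | yes stable = inj₁ (t , stable)
        ...   | no ¬stable = inj₂ (ℤP.i<j⇒suc[i]≤j (ℤP.≤-<-trans big (unstable-grows t ¬stable)))

        stable-exists : ∃ Stable
        stable-exists with growth (n G)
        ... | inj₁ stable = stable
        ... | inj₂ big = contradiction (ℤP.≤-trans big bounded) (λ { (ℤ.+≤+ n<n) → ℕP.<-irrefl refl n<n })
          where
          bounded : #reach (n G) ≤ + n G
          bounded = ℤP.≤-trans (∑-mono-≤ (λ u → 𝟙≤1 (reach (n G) u)))
                               (ℤP.≤-reflexive (trans (∑-const {n G} 1ℤ) (ℤP.*-identityʳ (+ n G))))

        stable⇒closed : ∀ {t} → Stable t → ResidualClosed S (reach t)
        stable⇒closed {t} stable e He Rt = trans (sym (stable h)) (trans (cong (reach t h ∨_) step) (Bool.∨-zeroʳ (reach t h)))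
          where
          h = head G (residual S) e
          step : anyᵇ (λ e′ → H e′ ∧ reach t (tail G (residual S) e′) ∧ does (head G (residual S) e′ ≟ h)) ≡ true
          step = anyᵇ-intro _ e (cong₂ _∧_ He (cong₂ _∧_ Rt (dec-true (h ≟ h) refl)))

        reach-antimono : ∀ t u → reach (suc t) u ≡ false → reach t u ≡ false
        reach-antimono t u unreached = Bool.¬-not (λ Rtu → case trans (sym (reach-mono t u Rtu)) unreached of λ ())

        -- The path to u only toggles edges whose residual head lies in layer t, so the edge
        -- along which a new vertex is first entered has not been toggled before.
        record Augmentation (t : ℕ) (u : V G) : Set where
          field
            shift     : Shift S v₀ u
            untouched : ∀ e → reach t (head G (residual S) e) ≡ false → Shift.S′ shift e ≡ S e

        augmentation : ∀ t u → reach t u ≡ true → Augmentation t u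
        augmentation zero u v₀≡u with dec-true⁻¹ (v₀ ≟ u) v₀≡u
        ... | refl = record
          { shift = record { S′ = S ; S′⊆H = S⊆H ; net-S′ = λ v → cancel (net D S v) (δ v₀ v) }
          ; untouched = λ _ _ → refl }
          where
          cancel : ∀ x a → x ≡ x - a + a
          cancel = solve-∀
        augmentation (suc t) u Rsuc with reach t u in Rtu
        ... | true = record
          { shift = Augmentation.shift earlier
          ; untouched = λ e unreached → Augmentation.untouched earlier e (reach-antimono t _ unreached) }
          where earlier = augmentation t u Rtu
        ... | false = extend (anyᵇ-elim _ Rsuc)
          where
          extend : (∃ λ e₀ → H e₀ ∧ reach t (tail G (residual S) e₀) ∧ does (head G (residual S) e₀ ≟ u) ≡ true) →
                   Augmentation (suc t) u
          extend (e₀ , step) =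
            record { shift = record { S′ = S′ ; S′⊆H = S′⊆H ; net-S′ = net-S′ } ; untouched = untouched }
            where
            He₀ = proj₁ (∧-true {H e₀} step)
            w = tail G (residual S) e₀
            Rw : reach t w ≡ true
            Rw = proj₁ (∧-true {reach t w} (proj₂ (∧-true {H e₀} step)))
            h≡u : head G (residual S) e₀ ≡ u
            h≡u = dec-true⁻¹ (head G (residual S) e₀ ≟ u) (proj₂ (∧-true {reach t w} (proj₂ (∧-true {H e₀} step))))
            earlier = augmentation t w Rw
            S₁ = Shift.S′ (Augmentation.shift earlier)
            S₁e₀≡Se₀ : S₁ e₀ ≡ S e₀
            S₁e₀≡Se₀ = Augmentation.untouched earlier e₀ (trans (cong (reach t) h≡u) Rtu)
            S′ = toggle e₀ S₁
            S′⊆H : S′ ⊆ H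
            S′⊆H e S′e with e₀ ≟ e
            ... | yes refl = He₀
            ... | no _     = Shift.S′⊆H (Augmentation.shift earlier) e S′e
            net-S′ : ∀ v → net D S′ v ≡ net D S v - δ v₀ v + δ u v
            net-S′ v = begin
              net D S′ v                                     ≡⟨ net-toggle e₀ S₁ v ⟩
              net D S₁ v - incidence (residual S₁) e₀ v       ≡⟨ cong₂ _-_ (Shift.net-S′ (Augmentation.shift earlier) v)
                                                                           (incidence-cong {residual S₁} {residual S} e₀ (cong (λ b → if not b then not (D e₀) else D e₀) S₁e₀≡Se₀) v) ⟩
              net D S v - δ v₀ v + δ w v - (δ w v - δ (head G (residual S) e₀) v)
                                                              ≡⟨ cong (λ x → net D S v - δ v₀ v + δ w v - (δ w v - δ x v)) h≡u ⟩
              net D S v - δ v₀ v + δ w v - (δ w v - δ u v)    ≡⟨ cancel (net D S v) (δ v₀ v) (δ w v) (δ u v) ⟩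
              net D S v - δ v₀ v + δ u v                      ∎
              where
              open ≡-Reasoning
              cancel : ∀ x a b c → x - a + b - (b - c) ≡ x - a + c
              cancel = solve-∀
            reached : reach (suc t) u ≡ true
            reached = trans (cong (reach t u ∨_) (anyᵇ-intro _ e₀ step)) (Bool.∨-zeroʳ (reach t u))
            untouched : ∀ e → reach (suc t) (head G (residual S) e) ≡ false → toggle e₀ S₁ e ≡ S e
            untouched e unreached with e₀ ≟ e
            ... | yes refl = case trans (sym reached) (trans (cong (reach (suc t)) (sym h≡u)) unreached) of λ ()
            ... | no _     = Augmentation.untouched earlier e (reach-antimono t _ unreached)

      augment : ∀ {S} → S ⊆ H → ∀ {v₀} → 1ℤ ≤ excess S v₀ → ∃ λ u → excess S u < 0ℤ × Shift S v₀ u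
      augment {S} S⊆H {v₀} positive = from-stable stable-exists
        where
        open Search S⊆H v₀
        from-stable : ∃ Stable → ∃ λ u → excess S u < 0ℤ × Shift S v₀ u
        from-stable (t , stable) with any? (λ u → (reach t u Bool.≟ true) ×-dec (excess S u ℤP.<? 0ℤ))
        ... | yes (u , Ru , negative) = u , negative , Augmentation.shift (augmentation t u Ru)
        ... | no none = contradiction (closed⇒excess≤0 {S} {reach t} S⊆H (stable⇒closed {t} stable)) (ℤP.<⇒≱ 0<∑)
          where
          term≥0 : ∀ v → 0ℤ ≤ 𝟙 (reach t v) * excess S v
          term≥0 v with reach t v in Rv
          ... | false = ℤP.≤-refl
          ... | true  = subst (0ℤ ≤_) (sym (ℤP.*-identityˡ (excess S v))) (ℤP.≮⇒≥ (λ neg → none (v , Rv , neg)))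
          0<∑ : 0ℤ < ∑[ v < n G ] (𝟙 (reach t v) * excess S v)
          0<∑ = ℤP.<-≤-trans (ℤP.<-≤-trans (ℤ.+<+ (ℕ.s≤s ℕ.z≤n)) positive)
                  (subst (_≤ ∑[ v < n G ] (𝟙 (reach t v) * excess S v)) (trans (cong (λ b → 𝟙 b * excess S v₀) (reach-v₀ t)) (ℤP.*-identityˡ (excess S v₀)))
                         (∑-term-≤ term≥0 v₀))

      potential : (E G → Bool) → ℤ
      potential S = ∑[ v < n G ] (+ ∣ excess S v ∣)

      shift-decreases-potential : ∀ {S v₀ u} → 1ℤ ≤ excess S v₀ → excess S u < 0ℤ →
                                  (shift : Shift S v₀ u) → potential (Shift.S′ shift) < potential S
      shift-decreases-potential {S} {v₀} {u} positive negative shift = ℤP.suc[i]≤j⇒i<j (begin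
        1ℤ + potential S′
          ≡⟨ cong (λ x → 1ℤ + x) (sum-cong-≗ pointwise) ⟩
        1ℤ + ∑[ v < n G ] (+ ∣ excess S v ∣ - δ v₀ v - δ u v)
          ≡⟨ cong (λ x → 1ℤ + x) (trans (∑-distrib-- _ (λ v → δ u v)) (cong₂ _-_ (∑-distrib-- _ (λ v → δ v₀ v)) (∑-δ₁ u))) ⟩
        1ℤ + (potential S - ∑[ v < n G ] δ v₀ v - 1ℤ)
          ≡⟨ cong (λ x → 1ℤ + (potential S - x - 1ℤ)) (∑-δ₁ v₀) ⟩
        1ℤ + (potential S - 1ℤ - 1ℤ)
          ≡⟨ regroup (potential S) ⟩
        potential S - 1ℤ
          ≤⟨ ℤP.i-j≤i (potential S) 1ℤ ⟩
        potential S ∎)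
        where
        open ℤP.≤-Reasoning
        S′ = Shift.S′ shift
        regroup : ∀ x → 1ℤ + (x - 1ℤ - 1ℤ) ≡ x - 1ℤ
        regroup = solve-∀
        moved : ∀ v → excess S′ v ≡ excess S v - δ v₀ v + δ u v
        moved v = trans (cong (_- f v) (Shift.net-S′ shift v)) (rearrange (net D S v) (δ v₀ v) (δ u v) (f v))
          where
          rearrange : ∀ x a b c → x - a + b - c ≡ x - c - a + b
          rearrange = solve-∀
        pointwise : ∀ v → + ∣ excess S′ v ∣ ≡ + ∣ excess S v ∣ - δ v₀ v - δ u v
        pointwise v = trans (cong (λ y → + ∣ y ∣) (moved v))
          (+∣∣-move (excess S v) (does (v₀ ≟ v)) (does (u ≟ v))
            (λ at-v₀ → case dec-true⁻¹ (v₀ ≟ v) at-v₀ of λ { refl → positive })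
            (λ at-u → case dec-true⁻¹ (u ≟ v) at-u of λ { refl → negative }))

      balanced-subset : ∀ fuel S → S ⊆ H → potential S ≤ + fuel → ∃ λ S′ → S′ ⊆ H × (∀ v → net D S′ v ≡ f v)
      balanced-subset fuel S S⊆H bound with any? (λ v → 0ℤ ℤP.<? excess S v)
      ... | no none =
        S , S⊆H , λ v → ℤP.i-j≡0⇒i≡j _ _ (∑-nonpos-≡0 (λ v → ℤP.≮⇒≥ (λ pos → none (v , pos))) (∑-excess S) v)
      balanced-subset zero S S⊆H bound | yes (v₀ , positive) =
        contradiction (ℤP.≤-trans (ℤP.≤-trans (ℤP.i<j⇒suc[i]≤j positive) (ℤP.≤-reflexive (sym (ℤP.0≤i⇒+∣i∣≡i (ℤP.<⇒≤ positive)))))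
                                  (ℤP.≤-trans (∑-term-≤ (λ v → ℤ.+≤+ ℕ.z≤n) v₀) bound))
                      (λ { (ℤ.+≤+ ()) })
      balanced-subset (suc fuel) S S⊆H bound | yes (v₀ , positive) = continue (augment S⊆H (ℤP.i<j⇒suc[i]≤j positive))
        where
        continue : (∃ λ u → excess S u < 0ℤ × Shift S v₀ u) → ∃ λ S′ → S′ ⊆ H × (∀ v → net D S′ v ≡ f v)
        continue (u , negative , shift) =
          balanced-subset fuel (Shift.S′ shift) (Shift.S′⊆H shift)
            (ℤP.i<j⇒i≤pred[j] (ℤP.<-≤-trans (shift-decreases-potential (ℤP.i<j⇒suc[i]≤j positive) negative shift) bound))

    split-off : ∀ H f k → (∀ v → net D H v ≡ + suc k * f v) → ∃ λ S → S ⊆ H × (∀ v → net D S v ≡ f v)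
    split-off H f k H≡kf =
      balanced-subset _ ∅ (λ _ ())
        (ℤP.≤-reflexive (sym (ℤP.0≤i⇒+∣i∣≡i (∑-nonneg {f = λ v → + ∣ excess ∅ v ∣} (λ v → ℤ.+≤+ ℕ.z≤n)))))
      where
      open Augmenting H f k H≡kf
      ∅ : E G → Bool
      ∅ _ = false

    equipartition : ∀ H f k → (∀ v → net D H v ≡ + suc k * f v) →
      ∃ λ (class : E G → Fin (suc k)) → ∀ i v → net D (λ e → H e ∧ inClass {G} class i e) v ≡ f v
    equipartition H f zero H≡f = (λ _ → zero) , λ { zero v →
      trans (net-cong D (λ e → Bool.∧-identityʳ (H e)) v) (trans (H≡f v) (ℤP.*-identityˡ (f v))) }
    equipartition H f (suc k) H≡kf = refine (split-off H f (suc k) H≡kf)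
      where
      refine : (∃ λ S → S ⊆ H × (∀ v → net D S v ≡ f v)) →
               ∃ λ (class : E G → Fin (suc (suc k))) → ∀ i v → net D (λ e → H e ∧ inClass {G} class i e) v ≡ f v
      refine (S , S⊆H , S≡f) = class , class≡f
        where
        rest≡kf : ∀ v → net D (λ e → H e ∧ not (S e)) v ≡ + suc k * f v
        rest≡kf v = trans (net-∖ D S⊆H v) (trans (cong₂ _-_ (H≡kf v) (S≡f v)) (peel (+ k) (f v)))
          where
          peel : ∀ k x → (1ℤ + (1ℤ + k)) * x - x ≡ (1ℤ + k) * x
          peel = solve-∀
        rest = equipartition (λ e → H e ∧ not (S e)) f k rest≡kf
        class : E G → Fin (suc (suc k))
        class e = if S e then zero else suc (proj₁ rest e)
        first : ∀ e → H e ∧ inClass {G} class zero e ≡ S e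
        first e with S e in Se
        ... | true  = trans (Bool.∧-identityʳ (H e)) (S⊆H e Se)
        ... | false = Bool.∧-zeroʳ (H e)
        later : ∀ i e → H e ∧ inClass {G} class (suc i) e ≡ (H e ∧ not (S e)) ∧ inClass {G} (proj₁ rest) i e
        later i e with S e
        ... | true  = trans (Bool.∧-zeroʳ (H e)) (sym (cong (_∧ inClass {G} (proj₁ rest) i e) (Bool.∧-zeroʳ (H e))))
        ... | false = cong₂ _∧_ (sym (Bool.∧-identityʳ (H e))) (⌊⌋-map′ (cong suc) FinP.suc-injective (proj₁ rest e ≟ i))
        class≡f : ∀ i v → net D (λ e → H e ∧ inClass {G} class i e) v ≡ f v
        class≡f zero    v = trans (net-cong D first v) (S≡f v)
        class≡f (suc i) v = trans (net-cong D (later i) v) (proj₂ rest i v)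

module Orientability (G : Graph) where
  open NetDegree G
  open Cycles G
  open Splitting G

  positiveOn : (E G → Bool) → Signature G
  positiveOn S e = if S e then ⊕ else ⊖

  isPos-positiveOn : ∀ S e → isPos (positiveOn S e) ≡ S e
  isPos-positiveOn S e with S e
  ... | true  = refl
  ... | false = refl

  isNeg≡not-isPos : ∀ s → isNeg s ≡ not (isPos s)
  isNeg≡not-isPos ⊕ = refl
  isNeg≡not-isPos ⊖ = refl

  incidence-xor : ∀ D (P Q : E G → Bool) e v →
    𝟙 (P e xor Q e) * incidence (reverseOn (λ e → Q e ∧ not (P e)) D) e v ≡ (𝟙 (P e) - 𝟙 (Q e)) * incidence D e v
  incidence-xor D P Q e v with P e | Q e
  ... | true  | true  = refl
  ... | true  | false = refl
  ... | false | false = refl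
  ... | false | true  =
    trans (ℤP.*-identityˡ _) (trans (incidence-reverseOn (λ _ → true) D e v refl) (sym (ℤP.-1*i≡-i (incidence D e v))))

  goodPartition⇒modOrientable : ∀ k σ → (∃ λ part → GoodPartition G (suc k) σ part) → ModOrientable G (suc k) σ
  goodPartition⇒modOrientable k σ (part , classes , D , equal) = σ₀ , σ~σ₀ , D , modulo
    where
    σ₀ = proj₁ (classes zero)
    σ~σ₀ = proj₁ (proj₂ (classes zero))
    P : E G → Bool
    P e = isPos (σ₀ e)
    P≡class₀ : ∀ v → net D P v ≡ net D (inClass {G} part zero) v
    P≡class₀ = net-cong D (proj₂ (proj₂ (classes zero)))
    class≡class₀ : ∀ i v → net D (inClass {G} part i) v ≡ net D P v
    class≡class₀ i v =
      trans (sym (netDeg≡net D _ v)) (trans (equal v i zero) (trans (netDeg≡net D _ v) (sym (P≡class₀ v))))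
    all≡ : ∀ v → net D (λ _ → true) v ≡ + suc k * net D P v
    all≡ v = begin
      net D (λ _ → true) v                    ≡⟨ sym (net-partition D part v) ⟩
      ∑[ i < suc k ] net D (inClass {G} part i) v  ≡⟨ sum-cong-≗ (λ i → class≡class₀ i v) ⟩
      ∑[ i < suc k ] net D P v                ≡⟨ ∑-const {suc k} (net D P v) ⟩
      + suc k * net D P v                     ∎
      where open ≡-Reasoning
    modulo : IsModOrientation G (suc k) σ₀ D
    modulo v = begin
      (+ suc k - 1ℤ) * netDeg G D P v                      ≡⟨ cong ((+ suc k - 1ℤ) *_) (netDeg≡net D P v) ⟩
      (+ suc k - 1ℤ) * net D P v                          ≡⟨ distrib (+ k) (net D P v) ⟩
      + suc k * net D P v - net D P v                     ≡⟨ cong (_- net D P v) (sym (all≡ v)) ⟩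
      net D (λ _ → true) v - net D P v                    ≡⟨ sym (net-∖ D {λ _ → true} {P} (λ _ _ → refl) v) ⟩
      net D (λ e → not (P e)) v                           ≡⟨ net-cong D (λ e → sym (isNeg≡not-isPos (σ₀ e))) v ⟩
      net D (λ e → isNeg (σ₀ e)) v                        ≡⟨ sym (netDeg≡net D _ v) ⟩
      netDeg G D (λ e → isNeg (σ₀ e)) v                   ∎
      where
      open ≡-Reasoning
      distrib : ∀ k x → (1ℤ + k - 1ℤ) * x ≡ (1ℤ + k) * x - x
      distrib = solve-∀

  modOrientable⇒goodPartition : ∀ k σ → ModOrientable G (suc k) σ → ∃ λ part → GoodPartition G (suc k) σ part
  modOrientable⇒goodPartition k σ (σ′ , σ~σ′ , D , modulo) = refine (equipartition D (λ _ → true) f k all≡)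
    where
    P : E G → Bool
    P e = isPos (σ′ e)
    f : V G → ℤ
    f = net D P
    negative≡ : ∀ v → net D (λ e → isNeg (σ′ e)) v ≡ + k * f v
    negative≡ v = begin
      net D (λ e → isNeg (σ′ e)) v              ≡⟨ sym (netDeg≡net D _ v) ⟩
      netDeg G D (λ e → isNeg (σ′ e)) v         ≡⟨ sym (modulo v) ⟩
      (+ suc k - 1ℤ) * netDeg G D P v           ≡⟨ cong ((+ suc k - 1ℤ) *_) (netDeg≡net D P v) ⟩
      (+ suc k - 1ℤ) * f v                      ≡⟨ simplify (+ k) (f v) ⟩
      + k * f v                                 ∎
      where
      open ≡-Reasoning
      simplify : ∀ k x → (1ℤ + k - 1ℤ) * x ≡ k * x
      simplify = solve-∀
    all≡ : ∀ v → net D (λ _ → true) v ≡ + suc k * f v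
    all≡ v = begin
      net D (λ _ → true) v                                  ≡⟨ divergence-cong D (λ e → 𝟙-sign (σ′ e)) v ⟩
      divergence D (λ e → 𝟙 (P e) + 𝟙 (isNeg (σ′ e))) v    ≡⟨ divergence-+ D (λ e → 𝟙 (P e)) (λ e → 𝟙 (isNeg (σ′ e))) v ⟩
      f v + net D (λ e → isNeg (σ′ e)) v                    ≡⟨ cong (λ x → f v + x) (negative≡ v) ⟩
      f v + + k * f v                                       ≡⟨ collect (+ k) (f v) ⟩
      + suc k * f v                                         ∎
      where
      open ≡-Reasoning
      𝟙-sign : ∀ s → 𝟙 true ≡ 𝟙 (isPos s) + 𝟙 (isNeg s)
      𝟙-sign ⊕ = refl
      𝟙-sign ⊖ = refl
      collect : ∀ k x → x + k * x ≡ (1ℤ + k) * x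
      collect = solve-∀
    refine : (∃ λ (class : E G → Fin (suc k)) → ∀ i v → net D (inClass {G} class i) v ≡ f v) →
             ∃ λ part → GoodPartition G (suc k) σ part
    refine (class , class≡f) = class , classes , D , equal
      where
      netDeg≡f : ∀ i v → netDeg G D (inClass {G} class i) v ≡ f v
      netDeg≡f i v = trans (netDeg≡net D _ v) (class≡f i v)
      equal : ∀ v i j → netDeg G D (inClass {G} class i) v ≡ netDeg G D (inClass {G} class j) v
      equal v i j = trans (netDeg≡f i v) (sym (netDeg≡f j v))
      classes : ∀ i → ∃ λ σᵢ → InvEquiv G σ σᵢ × (∀ e → isPos (σᵢ e) ≡ inClass {G} class i e)
      classes i = let σᵢ , σ′~σᵢ , σᵢ≗τ = balanced⇒invEquiv Dᵢ σ′ τ balanced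
                  in σᵢ , σ~σ′ ◅◅ σ′~σᵢ , λ e → trans (cong isPos (σᵢ≗τ e)) (isPos-positiveOn (inClass {G} class i) e)
        where
        τ = positiveOn (inClass {G} class i)
        Q : E G → Bool
        Q e = isPos (τ e)
        -- σ′ and τ disagree on P Δ Eᵢ; reversing Eᵢ ∖ P gives it net degree net P − net Eᵢ = 0.
        Dᵢ = reverseOn (λ e → Q e ∧ not (P e)) D

        balanced : Balanced Dᵢ (disagree σ′ τ)
        balanced v = begin
          net Dᵢ (disagree σ′ τ) v                              ≡⟨ sum-cong-≗ (λ e → incidence-xor D P Q e v) ⟩
          divergence D (λ e → 𝟙 (P e) - 𝟙 (Q e)) v             ≡⟨ divergence-- D (λ e → 𝟙 (P e)) (λ e → 𝟙 (Q e)) v ⟩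
          f v - net D Q v
            ≡⟨ cong (λ x → f v - x) (trans (net-cong D (isPos-positiveOn (inClass {G} class i)) v) (class≡f i v)) ⟩

          f v - f v                                             ≡⟨ ℤP.+-inverseʳ (f v) ⟩
          0ℤ                                                    ∎
          where open ≡-Reasoning

theorem4p3 : (ℓ : ℕ) → 1 ℕ.≤ ℓ → (G : Graph) → (σ : Signature G) →
    ModOrientable G ℓ σ ⇔ (∃ λ (part : E G → Fin ℓ) → GoodPartition G ℓ σ part)
theorem4p3 (suc k) _ G σ = mk⇔ (modOrientable⇒goodPartition k σ) (goodPartition⇒modOrientable k σ)
  where open Orientability G
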